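{- Let $k\in\mathbb{P}$ and let $I_k$ denote the $k$-element chain. Then \[ \mathrm{Ehr}(\mathcal{O}(I_1\oplus(I_k+I_k)),x)=\sum_{n\ge0}\sum_{i=0}^n\binom{k+i}{k}^2x^n=\frac{\sum_{i=0}^k\binom{k}{i}^2x^i}{(1-x)^{2k+2}}. \]
   Context: For a finite poset $(P,\preceq)$ on $[p]$, the order polytope $\mathcal{O}(P)\subset\mathbb{R}^p$ is defined by $0\le x_i\le 1$ and $x_i\le x_j$ whenever $i\prec j$. For an integral polytope $\mathcal{Q}\subset\mathbb{R}^p$, $\mathrm{ehr}(\mathcal{Q},n)=|n\mathcal{Q}\cap\mathbb{Z}^p|$ ($n\ge1$), and $\mathrm{Ehr}(\mathcal{Q},x)=1+\sum_{n\ge1}\mathrm{ehr}(\mathcal{Q},n)x^n$. The direct sum $P_1+P_2$ is the disjoint union with no relations between $P_1$ and $P_2$; the ordinal sum $P_1\oplus P_2$ is the disjoint union keeping the orders of $P_1,P_2$ and declaring every element of $P_1$ below every element of $P_2$. -}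

module Defs where

open import Data.Nat as ℕ using (ℕ; zero; suc; _+_; _*_; _∸_; _^_; _≤_; _≤?_)
open import Data.Nat.Combinatorics using (_C_)
open import Data.Integer as ℤ using (ℤ; +_)
open import Data.Fin as Fin using (Fin; splitAt)
open import Data.Fin.Properties using () renaming (_≤?_ to _≤ᶠ?_)
open import Data.Sum using (_⊎_; inj₁; inj₂)
open import Data.Unit using (⊤; tt)
open import Data.Empty using (⊥)
open import Data.List using (List; []; _∷_; map; concatMap; filter; length; allFin; upTo)
open import Data.Vec as Vec using (Vec; lookup)
open import Data.Product using (_×_; _,_)
open import Relation.Nullary using (Dec; yes; no; ¬_)
open import Relation.Nullary.Decidable using (_×-dec_)
open import Relation.Unary using (Decidable)
open import Data.List.Relation.Unary.All using (All)
open import Data.List.Relation.Unary.All as All using ()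
import Data.List.Relation.Unary.All.Properties as AllP

-- Finite posets on the ground set Fin size, given by a decidable
-- (reflexive) order relation _⪯_.  (Only the relation matters for the
-- order polytope: x_i ≤ x_j whenever i ≺ j is equivalent to
-- x_i ≤ x_j whenever i ⪯ j.)

record FinPoset : Set₁ where
  field
    size : ℕ
    _⪯_  : Fin size → Fin size → Set
    _⪯?_ : (i j : Fin size) → Dec (i ⪯ j)
open FinPoset public

chain : ℕ → FinPoset
chain k = record { size = k ; _⪯_ = Fin._≤_ ; _⪯?_ = _≤ᶠ?_ }

_+P_ : FinPoset → FinPoset → FinPoset
P +P Q = record { size = size P + size Q ; _⪯_ = R ; _⪯?_ = R? }
  where
  Rs : Fin (size P) ⊎ Fin (size Q) → Fin (size P) ⊎ Fin (size Q) → Set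
  Rs (inj₁ a) (inj₁ b) = _⪯_ P a b
  Rs (inj₂ a) (inj₂ b) = _⪯_ Q a b
  Rs _        _        = ⊥
  Rs? : ∀ x y → Dec (Rs x y)
  Rs? (inj₁ a) (inj₁ b) = _⪯?_ P a b
  Rs? (inj₂ a) (inj₂ b) = _⪯?_ Q a b
  Rs? (inj₁ a) (inj₂ b) = no λ ()
  Rs? (inj₂ a) (inj₁ b) = no λ ()
  R : Fin (size P + size Q) → Fin (size P + size Q) → Set
  R i j = Rs (splitAt (size P) i) (splitAt (size P) j)
  R? : ∀ i j → Dec (R i j)
  R? i j = Rs? (splitAt (size P) i) (splitAt (size P) j)

_⊕P_ : FinPoset → FinPoset → FinPoset
P ⊕P Q = record { size = size P + size Q ; _⪯_ = R ; _⪯?_ = R? }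
  where
  Rs : Fin (size P) ⊎ Fin (size Q) → Fin (size P) ⊎ Fin (size Q) → Set
  Rs (inj₁ a) (inj₁ b) = _⪯_ P a b
  Rs (inj₂ a) (inj₂ b) = _⪯_ Q a b
  Rs (inj₁ a) (inj₂ b) = ⊤
  Rs (inj₂ a) (inj₁ b) = ⊥
  Rs? : ∀ x y → Dec (Rs x y)
  Rs? (inj₁ a) (inj₁ b) = _⪯?_ P a b
  Rs? (inj₂ a) (inj₂ b) = _⪯?_ Q a b
  Rs? (inj₁ a) (inj₂ b) = yes tt
  Rs? (inj₂ a) (inj₁ b) = no λ ()
  R : Fin (size P + size Q) → Fin (size P + size Q) → Set
  R i j = Rs (splitAt (size P) i) (splitAt (size P) j)
  R? : ∀ i j → Dec (R i j)
  R? i j = Rs? (splitAt (size P) i) (splitAt (size P) j)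

box : ℕ → (p : ℕ) → List (Vec ℕ p)
box n zero    = Vec.[] ∷ []
box n (suc p) = concatMap (λ a → map (a Vec.∷_) (box n p)) (upTo (suc n))

OrderPreserving : (P : FinPoset) → Vec ℕ (size P) → Set
OrderPreserving P v =
  All (λ i → All (λ j → ¬ (_⪯_ P i j) ⊎ (lookup v i ≤ lookup v j)) (allFin (size P)))
      (allFin (size P))

orderPreserving? : (P : FinPoset) → Decidable (OrderPreserving P)
orderPreserving? P v =
  All.all? (λ i → All.all? (λ j → dec i j) (allFin (size P))) (allFin (size P))
  where
  dec : ∀ i j → Dec (¬ (_⪯_ P i j) ⊎ (lookup v i ≤ lookup v j))
  dec i j with _⪯?_ P i j | lookup v i ≤? lookup v j
  ... | _      | yes le = yes (inj₂ le)
  ... | no  ¬r | no _   = yes (inj₁ ¬r)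
  ... | yes r  | no ¬le = no λ { (inj₁ ¬r) → ¬r r ; (inj₂ le) → ¬le le }

-- ehr(O(P), n) = | nO(P) ∩ ℤ^p |
ehr : FinPoset → ℕ → ℕ
ehr P n = length (filter (orderPreserving? P) (box n (size P)))

Series : Set
Series = ℕ → ℤ

Ehr : FinPoset → Series
Ehr P zero    = + 1
Ehr P (suc n) = + ehr P (suc n)

sumTo : ℕ → (ℕ → ℤ) → ℤ
sumTo zero    f = f 0
sumTo (suc n) f = sumTo n f ℤ.+ f (suc n)

sumToℕ : ℕ → (ℕ → ℕ) → ℕ
sumToℕ zero    f = f 0
sumToℕ (suc n) f = sumToℕ n f + f (suc n)

_*S_ : Series → Series → Series
(f *S g) n = sumTo n (λ j → f j ℤ.* g (n ∸ j))

oneS : Series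
oneS zero    = + 1
oneS (suc _) = + 0

oneMinusX : Series
oneMinusX 0 = + 1
oneMinusX 1 = ℤ.- (+ 1)
oneMinusX (suc (suc _)) = + 0

_^S_ : Series → ℕ → Series
s ^S zero    = oneS
s ^S suc m   = s *S (s ^S m)

poly : ℕ → (ℕ → ℤ) → Series
poly d c n with n ≤? d
... | yes _ = c n
... | no  _ = + 0

-- A lattice point of n·O(I₁ ⊕ (Iₖ + Iₖ)) is a value a ≤ n at the bottom element together with
-- two weakly increasing sequences of length k in [a, n], one for each chain.  There are
-- C(k + n - a, k) such sequences, so ehr(n) = Σ_{i ≤ n} C(k + i, k)².  Two Vandermonde convolutions
-- and a trinomial revision give C(k + n, k)² = Σ_j C(k, j)² C(2k + n - j, 2k), that is
-- Σ_n C(k + n, k)² xⁿ = (Σ_j C(k, j)² xʲ) / (1 - x)^(2k + 1); taking partial sums divides by one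
-- more factor 1 - x.

module Submission where

open import Defs
open import Algebra.Bundles using (CommutativeSemiring)
import Algebra.Properties.CommutativeSemigroup as CommSemigroupProperties
open import Data.Empty using (⊥-elim)
open import Data.Fin using (zero; suc; splitAt; _↑ˡ_; _↑ʳ_)
open import Data.Fin.Properties using (splitAt-↑ˡ; splitAt-↑ʳ; splitAt⁻¹-↑ˡ; splitAt⁻¹-↑ʳ)
open import Data.Integer as ℤ using (+_)
import Data.Integer.Properties as ℤ
open import Data.List as List using (List; []; _∷_; map; concatMap; filter; length; applyUpTo; upTo)
open import Data.List.Membership.Propositional.Properties using (∈-allFin)
open import Data.List.Properties using (map-++; map-cong; map-∘)
import Data.List.Relation.Unary.All as ListAll
open import Data.List.Relation.Unary.All.Properties using (tabulate⁺)
open import Data.Nat as ℕ using (ℕ; zero; suc; _∸_; _!; _≤_; _<_; z≤n; s≤s; _≤?_)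
open import Data.Nat.Combinatorics
  using (_C_; nCn≡1; k>n⇒nCk≡0; nCk≡nC[n∸k]; nCk≡n!/k![n-k]!; k![n∸k]!∣n!; nCk+nC[k+1]≡[n+1]C[k+1])
open import Data.Nat.DivMod using (_/_; m/n*n≡m)
open import Data.Nat.ListAction using (sum)
open import Data.Nat.ListAction.Properties using (sum-++)
import Data.Nat.Properties as ℕ
open import Data.Nat.Solver using (module +-*-Solver)
open import Data.Product using (_×_; _,_)
open import Data.Sum using (_⊎_; inj₁; inj₂)
open import Data.Unit using (⊤; tt)
open import Data.Vec using (Vec; []; _∷_; _++_; lookup)
open import Data.Vec.Properties using (lookup-++ˡ; lookup-++ʳ)
open import Data.Vec.Relation.Unary.All as All using (All; []; _∷_)
open import Data.Vec.Relation.Unary.All.Properties using (lookup⁺; lookup⁻; ++⁺; ++⁻)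
open import Function using (_∘_)
open import Function.Bundles using (_⇔_; mk⇔; module Equivalence)
open import Relation.Nullary using (Dec; yes; no; ¬_; contradiction)
open import Relation.Nullary.Decidable using (_×-dec_)
open import Relation.Unary using (Pred; Decidable)
import Relation.Binary.PropositionalEquality as ≡

-- Finite sums

module FiniteSum {c ℓ} (R : CommutativeSemiring c ℓ) where

  open CommutativeSemiring R
  open CommSemigroupProperties +-commutativeSemigroup using (interchange)
  open import Relation.Binary.Reasoning.Setoid setoid

  ∑≤ : ℕ → (ℕ → Carrier) → Carrier
  ∑≤ zero    f = f 0
  ∑≤ (suc n) f = ∑≤ n f + f (suc n)

  syntax ∑≤ n (λ i → e) = ∑[ i ≤ n ] e

  ∑-cong : ∀ n {f g : ℕ → Carrier} → (∀ {i} → i ≤ n → f i ≈ g i) → ∑≤ n f ≈ ∑≤ n g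
  ∑-cong zero    f≈g = f≈g z≤n
  ∑-cong (suc n) f≈g = +-cong (∑-cong n (f≈g ∘ ℕ.m≤n⇒m≤1+n)) (f≈g ℕ.≤-refl)

  ∑-suc : ∀ n f → ∑≤ (suc n) f ≈ f 0 + ∑[ i ≤ n ] f (suc i)
  ∑-suc zero    f = refl
  ∑-suc (suc n) f = begin
    ∑≤ (suc n) f + f (suc (suc n))                      ≈⟨ +-congʳ (∑-suc n f) ⟩
    (f 0 + ∑[ i ≤ n ] f (suc i)) + f (suc (suc n))      ≈⟨ +-assoc _ _ _ ⟩
    f 0 + ∑[ i ≤ suc n ] f (suc i)                      ∎

  ∑-zero : ∀ n {f} → (∀ {i} → i ≤ n → f i ≈ 0#) → ∑≤ n f ≈ 0#
  ∑-zero n f≈0 = trans (∑-cong n f≈0) (zeros n)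
    where
    zeros : ∀ n → ∑[ i ≤ n ] 0# ≈ 0#
    zeros zero    = refl
    zeros (suc n) = trans (+-identityʳ _) (zeros n)

  ∑-distrib-+ : ∀ n f g → ∑[ i ≤ n ] (f i + g i) ≈ ∑≤ n f + ∑≤ n g
  ∑-distrib-+ zero    f g = refl
  ∑-distrib-+ (suc n) f g = trans (+-congʳ (∑-distrib-+ n f g)) (interchange _ _ _ _)

  *-distribˡ-∑ : ∀ n x f → x * ∑≤ n f ≈ ∑[ i ≤ n ] (x * f i)
  *-distribˡ-∑ zero    x f = refl
  *-distribˡ-∑ (suc n) x f = trans (distribˡ x _ _) (+-congʳ (*-distribˡ-∑ n x f))

  *-distribʳ-∑ : ∀ n x f → ∑≤ n f * x ≈ ∑[ i ≤ n ] (f i * x)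
  *-distribʳ-∑ n x f = begin
    ∑≤ n f * x               ≈⟨ *-comm _ x ⟩
    x * ∑≤ n f               ≈⟨ *-distribˡ-∑ n x f ⟩
    ∑[ i ≤ n ] (x * f i)     ≈⟨ ∑-cong n (λ {i} _ → *-comm x (f i)) ⟩
    ∑[ i ≤ n ] (f i * x)     ∎

  ∑-shrink : ∀ {m n} f → m ≤ n → (∀ {i} → m < i → f i ≈ 0#) → ∑≤ n f ≈ ∑≤ m f
  ∑-shrink {m} f m≤n tail≈0 = trans (reflexive (≡.cong (λ n → ∑≤ n f) (≡.sym (ℕ.m∸n+n≡m m≤n)))) (go (_ ∸ m))
    where
    go : ∀ d → ∑≤ (d ℕ.+ m) f ≈ ∑≤ m f
    go zero    = refl
    go (suc d) = trans (+-cong (go d) (tail≈0 (s≤s (ℕ.m≤n+m m d)))) (+-identityʳ _)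

  ∑-reverse : ∀ n f → ∑≤ n f ≈ ∑[ i ≤ n ] f (n ∸ i)
  ∑-reverse zero    f = refl
  ∑-reverse (suc n) f = begin
    ∑≤ n f + f (suc n)                    ≈⟨ +-congʳ (∑-reverse n f) ⟩
    ∑[ i ≤ n ] f (n ∸ i) + f (suc n)      ≈⟨ +-comm _ _ ⟩
    f (suc n) + ∑[ i ≤ n ] f (n ∸ i)      ≈⟨ sym (∑-suc n (λ i → f (suc n ∸ i))) ⟩
    ∑[ i ≤ suc n ] f (suc n ∸ i)          ∎

  ∑-comm : ∀ m n (F : ℕ → ℕ → Carrier) → ∑[ i ≤ m ] ∑[ j ≤ n ] F i j ≈ ∑[ j ≤ n ] ∑[ i ≤ m ] F i j
  ∑-comm zero    n F = refl
  ∑-comm (suc m) n F = trans (+-congʳ (∑-comm m n F)) (sym (∑-distrib-+ n _ _))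

  ∑-triangle : ∀ n (F : ℕ → ℕ → Carrier) →
               ∑[ j ≤ n ] ∑[ i ≤ j ] F i j ≈ ∑[ i ≤ n ] ∑[ l ≤ n ∸ i ] F i (i ℕ.+ l)
  ∑-triangle zero    F = refl
  ∑-triangle (suc n) F = begin
    ∑[ j ≤ n ] ∑[ i ≤ j ] F i j + (∑[ i ≤ n ] F i (suc n) + F (suc n) (suc n))
      ≈⟨ +-congʳ (∑-triangle n F) ⟩
    ∑[ i ≤ n ] ∑[ l ≤ n ∸ i ] F i (i ℕ.+ l) + (∑[ i ≤ n ] F i (suc n) + F (suc n) (suc n))
      ≈⟨ sym (+-assoc _ _ _) ⟩
    (∑[ i ≤ n ] ∑[ l ≤ n ∸ i ] F i (i ℕ.+ l) + ∑[ i ≤ n ] F i (suc n)) + F (suc n) (suc n)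
      ≈⟨ +-cong (trans (sym (∑-distrib-+ n _ _)) (∑-cong n extend-row)) last-row ⟩
    ∑[ i ≤ n ] ∑[ l ≤ suc n ∸ i ] F i (i ℕ.+ l) + ∑[ l ≤ suc n ∸ suc n ] F (suc n) (suc n ℕ.+ l)
      ∎
    where
    extend-row : ∀ {i} → i ≤ n → ∑[ l ≤ n ∸ i ] F i (i ℕ.+ l) + F i (suc n) ≈ ∑[ l ≤ suc n ∸ i ] F i (i ℕ.+ l)
    extend-row {i} i≤n = begin
      ∑[ l ≤ n ∸ i ] F i (i ℕ.+ l) + F i (suc n)
        ≡⟨ ≡.cong (λ x → ∑[ l ≤ n ∸ i ] F i (i ℕ.+ l) + F i x)
                  (≡.sym (≡.trans (ℕ.+-suc i (n ∸ i)) (≡.cong suc (ℕ.m+[n∸m]≡n i≤n)))) ⟩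
      ∑[ l ≤ suc (n ∸ i) ] F i (i ℕ.+ l)
        ≡⟨ ≡.cong (λ m → ∑[ l ≤ m ] F i (i ℕ.+ l)) (≡.sym (ℕ.+-∸-assoc 1 i≤n)) ⟩
      ∑[ l ≤ suc n ∸ i ] F i (i ℕ.+ l)
        ∎
    last-row : F (suc n) (suc n) ≈ ∑[ l ≤ suc n ∸ suc n ] F (suc n) (suc n ℕ.+ l)
    last-row = begin
      F (suc n) (suc n)
        ≡⟨ ≡.cong (F (suc n)) (≡.sym (ℕ.+-identityʳ (suc n))) ⟩
      ∑[ l ≤ 0 ] F (suc n) (suc n ℕ.+ l)
        ≡⟨ ≡.cong (λ m → ∑[ l ≤ m ] F (suc n) (suc n ℕ.+ l)) (≡.sym (ℕ.n∸n≡0 n)) ⟩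
      ∑[ l ≤ suc n ∸ suc n ] F (suc n) (suc n ℕ.+ l)
        ∎

open import Data.Nat using (_+_; _*_)
open ≡ using (_≡_; _≗_; refl; sym; trans; cong; cong₂; subst; subst₂)
open ≡.≡-Reasoning
open FiniteSum ℕ.+-*-commutativeSemiring
module +-CS = CommSemigroupProperties ℕ.+-commutativeSemigroup
module *-CS = CommSemigroupProperties ℕ.*-commutativeSemigroup

sumToℕ≡∑ : ∀ n f → sumToℕ n f ≡ ∑≤ n f
sumToℕ≡∑ zero    f = refl
sumToℕ≡∑ (suc n) f = cong (_+ f (suc n)) (sumToℕ≡∑ n f)

-- Binomial coefficients

infix 9 _²
_² : ℕ → ℕ
n ² = n * n

[n+0]Cn≡1 : ∀ n → (n + 0) C n ≡ 1
[n+0]Cn≡1 n = trans (cong (_C n) (ℕ.+-identityʳ n)) (nCn≡1 n)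

C-pascal : ∀ n k → suc n C suc k ≡ n C k + n C suc k
C-pascal n k = sym (nCk+nC[k+1]≡[n+1]C[k+1] n k)

C-factorials : ∀ m n → ((m + n) C m) * (m ! * n !) ≡ (m + n) !
C-factorials m n = begin
  ((m + n) C m) * (m ! * n !)
    ≡⟨ cong (λ x → ((m + n) C m) * (m ! * x !)) (sym (ℕ.m+n∸m≡n m n)) ⟩
  ((m + n) C m) * (m ! * (m + n ∸ m) !)
    ≡⟨ cong (_* (m ! * (m + n ∸ m) !)) (nCk≡n!/k![n-k]! m≤m+n) ⟩
  (m + n) ! / (m ! * (m + n ∸ m) !) * (m ! * (m + n ∸ m) !)
    ≡⟨ m/n*n≡m (k![n∸k]!∣n! m≤m+n) ⟩
  (m + n) !
    ∎
  where
  m≤m+n : m ≤ m + n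
  m≤m+n = ℕ.m≤m+n m n
  instance
    m!*n!≢0 : ℕ.NonZero (m ! * (m + n ∸ m) !)
    m!*n!≢0 = ℕ._!*_!≢0 m (m + n ∸ m)

-- Both sides times a! b! c! equal (a + b + c)!.
C-trinomial : ∀ a b c → ((a + b + c) C (a + b)) * ((a + b) C a) ≡ ((a + (b + c)) C a) * ((b + c) C b)
C-trinomial a b c = ℕ.*-cancelʳ-≡ _ _ (a ! * (b ! * c !)) (begin
  ((a + b + c) C (a + b)) * ((a + b) C a) * (a ! * (b ! * c !))
    ≡⟨ solve 5 (λ x y p q r → (x :* y) :* (p :* (q :* r)) := x :* ((y :* (p :* q)) :* r)) refl
             ((a + b + c) C (a + b)) ((a + b) C a) (a !) (b !) (c !) ⟩
  ((a + b + c) C (a + b)) * (((a + b) C a) * (a ! * b !) * c !)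
    ≡⟨ cong (λ x → ((a + b + c) C (a + b)) * (x * c !)) (C-factorials a b) ⟩
  ((a + b + c) C (a + b)) * ((a + b) ! * c !)
    ≡⟨ C-factorials (a + b) c ⟩
  (a + b + c) !
    ≡⟨ cong _! (ℕ.+-assoc a b c) ⟩
  (a + (b + c)) !
    ≡⟨ sym (C-factorials a (b + c)) ⟩
  ((a + (b + c)) C a) * (a ! * (b + c) !)
    ≡⟨ cong (λ x → ((a + (b + c)) C a) * (a ! * x)) (sym (C-factorials b c)) ⟩
  ((a + (b + c)) C a) * (a ! * (((b + c) C b) * (b ! * c !)))
    ≡⟨ solve 5 (λ x y p q r → x :* (p :* (y :* (q :* r))) := (x :* y) :* (p :* (q :* r))) refl
             ((a + (b + c)) C a) ((b + c) C b) (a !) (b !) (c !) ⟩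
  ((a + (b + c)) C a) * ((b + c) C b) * (a ! * (b ! * c !))   ∎)
  where
  open +-*-Solver using (solve; _:*_; _:=_)
  instance
    a!*b!*c!≢0 : ℕ.NonZero (a ! * (b ! * c !))
    a!*b!*c!≢0 = ℕ.m*n≢0 (a !) (b ! * c !) {{ℕ._!≢0 a}} {{ℕ._!*_!≢0 b c}}

C-revision : ∀ N {m a} → a ≤ m → (N C m) * (m C a) ≡ (N C a) * ((N ∸ a) C (m ∸ a))
C-revision N {m} {a} a≤m with m ≤? N
... | no m≰N = trans (cong (_* (m C a)) (k>n⇒nCk≡0 N<m)) (sym rhs≡0)
  where
  N<m : N < m
  N<m = ℕ.≰⇒> m≰N
  rhs≡0 : (N C a) * ((N ∸ a) C (m ∸ a)) ≡ 0
  rhs≡0 with a ≤? N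
  ... | yes a≤N = trans (cong ((N C a) *_) (k>n⇒nCk≡0 (ℕ.∸-monoˡ-< N<m a≤N))) (ℕ.*-zeroʳ (N C a))
  ... | no a≰N  = cong (_* ((N ∸ a) C (m ∸ a))) (k>n⇒nCk≡0 (ℕ.≰⇒> a≰N))
C-revision N {m} {a} a≤m | yes m≤N with ℕ.m≤n⇒∃[o]m+o≡n a≤m | ℕ.m≤n⇒∃[o]m+o≡n m≤N
...   | b , refl | c , refl = begin
  ((a + b + c) C (a + b)) * ((a + b) C a)
    ≡⟨ C-trinomial a b c ⟩
  ((a + (b + c)) C a) * ((b + c) C b)
    ≡⟨ cong₂ (λ x y → (x C a) * (y C b)) (sym (ℕ.+-assoc a b c)) b+c≡a+b+c∸a ⟩
  ((a + b + c) C a) * ((a + b + c ∸ a) C b)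
    ≡⟨ cong (λ x → ((a + b + c) C a) * ((a + b + c ∸ a) C x)) (sym (ℕ.m+n∸m≡n a b)) ⟩
  ((a + b + c) C a) * ((a + b + c ∸ a) C (a + b ∸ a))
    ∎
  where
  b+c≡a+b+c∸a : b + c ≡ a + b + c ∸ a
  b+c≡a+b+c∸a = sym (trans (cong (_∸ a) (ℕ.+-assoc a b c)) (ℕ.m+n∸m≡n a (b + c)))

C-swap : ∀ n i j → (n C i) * ((n ∸ i) C j) ≡ (n C j) * ((n ∸ j) C i)
C-swap n i j = begin
  (n C i) * ((n ∸ i) C j)                   ≡⟨ cong (λ x → (n C i) * ((n ∸ i) C x)) (sym (ℕ.m+n∸m≡n i j)) ⟩
  (n C i) * ((n ∸ i) C (i + j ∸ i))         ≡⟨ sym (C-revision n (ℕ.m≤m+n i j)) ⟩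
  (n C (i + j)) * ((i + j) C i)             ≡⟨ cong ((n C (i + j)) *_) (nCk≡nC[n∸k] (ℕ.m≤m+n i j)) ⟩
  (n C (i + j)) * ((i + j) C (i + j ∸ i))   ≡⟨ cong (λ x → (n C (i + j)) * ((i + j) C x)) (ℕ.m+n∸m≡n i j) ⟩
  (n C (i + j)) * ((i + j) C j)             ≡⟨ C-revision n (ℕ.m≤n+m j i) ⟩
  (n C j) * ((n ∸ j) C (i + j ∸ j))         ≡⟨ cong (λ x → (n C j) * ((n ∸ j) C x)) (ℕ.m+n∸n≡m i j) ⟩
  (n C j) * ((n ∸ j) C i)                   ∎

C-vandermonde : ∀ m n r → (m + n) C r ≡ ∑[ j ≤ r ] ((m C (r ∸ j)) * (n C j))
C-vandermonde m zero zero = cong (_C 0) (ℕ.+-identityʳ m)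
C-vandermonde m zero (suc r) = sym (begin
  ∑[ j ≤ suc r ] ((m C (suc r ∸ j)) * (0 C j))
    ≡⟨ ∑-suc r _ ⟩
  (m C suc r) * 1 + ∑[ j ≤ r ] ((m C (r ∸ j)) * 0)
    ≡⟨ cong₂ _+_ (ℕ.*-identityʳ _) (∑-zero r λ {j} _ → ℕ.*-zeroʳ (m C (r ∸ j))) ⟩
  m C suc r + 0
    ≡⟨ ℕ.+-identityʳ _ ⟩
  m C suc r
    ≡⟨ cong (_C suc r) (sym (ℕ.+-identityʳ m)) ⟩
  (m + 0) C suc r
    ∎)
C-vandermonde m (suc n) zero = refl
C-vandermonde m (suc n) (suc r) = begin
  (m + suc n) C suc r                       ≡⟨ cong (_C suc r) (ℕ.+-suc m n) ⟩
  suc (m + n) C suc r                       ≡⟨ C-pascal (m + n) r ⟩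
  (m + n) C r + (m + n) C suc r             ≡⟨ cong₂ _+_ (C-vandermonde m n r) (C-vandermonde m n (suc r)) ⟩
  S₀ + ∑[ j ≤ suc r ] ((m C (suc r ∸ j)) * (n C j))
                                            ≡⟨ cong (_+_ S₀) (∑-suc r _) ⟩
  S₀ + ((m C suc r) * 1 + S₁)               ≡⟨ +-CS.x∙yz≈y∙xz S₀ _ S₁ ⟩
  (m C suc r) * 1 + (S₀ + S₁)               ≡⟨ cong (_+_ ((m C suc r) * 1)) (sym (∑-distrib-+ r _ _)) ⟩
  (m C suc r) * 1 + ∑[ j ≤ r ] ((m C (r ∸ j)) * (n C j) + (m C (r ∸ j)) * (n C suc j))
                                            ≡⟨ cong (_+_ ((m C suc r) * 1)) (∑-cong r λ {j} _ → pascal-step j) ⟩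
  (m C suc r) * 1 + ∑[ j ≤ r ] ((m C (r ∸ j)) * (suc n C suc j))
                                            ≡⟨ sym (∑-suc r _) ⟩
  ∑[ j ≤ suc r ] ((m C (suc r ∸ j)) * (suc n C j)) ∎
  where
  S₀ S₁ : ℕ
  S₀ = ∑[ j ≤ r ] ((m C (r ∸ j)) * (n C j))
  S₁ = ∑[ j ≤ r ] ((m C (r ∸ j)) * (n C suc j))
  pascal-step : ∀ j → (m C (r ∸ j)) * (n C j) + (m C (r ∸ j)) * (n C suc j) ≡ (m C (r ∸ j)) * (suc n C suc j)
  pascal-step j = trans (sym (ℕ.*-distribˡ-+ (m C (r ∸ j)) _ _)) (cong ((m C (r ∸ j)) *_) (sym (C-pascal n j)))

∑-C*C : ∀ k n → ∑[ i ≤ k ] ((k C i) * (n C i)) ≡ (k + n) C k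
∑-C*C k n = sym (trans (C-vandermonde k n k) (∑-cong k λ i≤k → cong (_* _) (sym (nCk≡nC[n∸k] i≤k))))

∑-C-hockey : ∀ k n → ∑[ i ≤ n ] ((k + i) C k) ≡ (suc k + n) C suc k
∑-C-hockey k zero = trans ([n+0]Cn≡1 k) (sym ([n+0]Cn≡1 (suc k)))
∑-C-hockey k (suc n) = begin
  ∑[ i ≤ n ] ((k + i) C k) + (k + suc n) C k   ≡⟨ cong (_+ (k + suc n) C k) (∑-C-hockey k n) ⟩
  suc (k + n) C suc k + (k + suc n) C k        ≡⟨ cong (λ x → x C suc k + (k + suc n) C k) (sym (ℕ.+-suc k n)) ⟩
  (k + suc n) C suc k + (k + suc n) C k        ≡⟨ ℕ.+-comm ((k + suc n) C suc k) _ ⟩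
  (k + suc n) C k + (k + suc n) C suc k        ≡⟨ sym (C-pascal (k + suc n) k) ⟩
  (suc k + suc n) C suc k                      ∎

C-vandermonde-≤ : ∀ m {n r s} → n ≤ s → s ≤ r → (m + n) C r ≡ ∑[ j ≤ s ] ((m C (r ∸ j)) * (n C j))
C-vandermonde-≤ m {n} {r} {s} n≤s s≤r = trans (C-vandermonde m n r) (∑-shrink _ s≤r vanish)
  where
  vanish : ∀ {j} → s < j → (m C (r ∸ j)) * (n C j) ≡ 0
  vanish {j} s<j = trans (cong ((m C (r ∸ j)) *_) (k>n⇒nCk≡0 (ℕ.≤-<-trans n≤s s<j))) (ℕ.*-zeroʳ (m C (r ∸ j)))

∑-C²*C : ∀ k i → ∑[ j ≤ k ] ((k C j) ² * ((k ∸ j) C i)) ≡ (k C i) * ((k + (k ∸ i)) C k)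
∑-C²*C k i = begin
  ∑[ j ≤ k ] ((k C j) ² * ((k ∸ j) C i))          ≡⟨ ∑-cong k (λ {j} _ → swap j) ⟩
  ∑[ j ≤ k ] ((k C i) * ((k C j) * ((k ∸ i) C j))) ≡⟨ sym (*-distribˡ-∑ k (k C i) _) ⟩
  (k C i) * ∑[ j ≤ k ] ((k C j) * ((k ∸ i) C j))   ≡⟨ cong ((k C i) *_) (∑-C*C k (k ∸ i)) ⟩
  (k C i) * ((k + (k ∸ i)) C k)                     ∎
  where
  swap : ∀ j → (k C j) ² * ((k ∸ j) C i) ≡ (k C i) * ((k C j) * ((k ∸ i) C j))
  swap j = begin
    (k C j) * (k C j) * ((k ∸ j) C i)    ≡⟨ ℕ.*-assoc (k C j) _ _ ⟩
    (k C j) * ((k C j) * ((k ∸ j) C i))  ≡⟨ cong ((k C j) *_) (C-swap k j i) ⟩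
    (k C j) * ((k C i) * ((k ∸ i) C j))  ≡⟨ *-CS.x∙yz≈y∙xz (k C j) (k C i) ((k ∸ i) C j) ⟩
    (k C i) * ((k C j) * ((k ∸ i) C j))  ∎

C²-convolution-≤k : ∀ k n → ∑[ j ≤ k ] ((k C j) ² * ((k + n + (k ∸ j)) C (k + k))) ≡ ((k + n) C k) ²
C²-convolution-≤k k n = begin
  ∑[ j ≤ k ] ((k C j) ² * ((N + (k ∸ j)) C (k + k)))
    ≡⟨ ∑-cong k (λ {j} _ → cong ((k C j) ² *_) (C-vandermonde-≤ N (ℕ.m∸n≤m k j) (ℕ.m≤m+n k k))) ⟩
  ∑[ j ≤ k ] ((k C j) ² * ∑[ i ≤ k ] ((N C (k + k ∸ i)) * ((k ∸ j) C i)))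
    ≡⟨ ∑-cong k (λ {j} _ → trans (*-distribˡ-∑ k ((k C j) ²) _) (∑-cong k λ {i} _ →
         *-CS.x∙yz≈y∙xz ((k C j) ²) (N C (k + k ∸ i)) ((k ∸ j) C i))) ⟩
  ∑[ j ≤ k ] ∑[ i ≤ k ] ((N C (k + k ∸ i)) * ((k C j) ² * ((k ∸ j) C i)))
    ≡⟨ ∑-comm k k _ ⟩
  ∑[ i ≤ k ] ∑[ j ≤ k ] ((N C (k + k ∸ i)) * ((k C j) ² * ((k ∸ j) C i)))
    ≡⟨ ∑-cong k (λ {i} _ → trans (sym (*-distribˡ-∑ k (N C (k + k ∸ i)) _))
                                 (cong ((N C (k + k ∸ i)) *_) (∑-C²*C k i))) ⟩
  ∑[ i ≤ k ] ((N C (k + k ∸ i)) * ((k C i) * ((k + (k ∸ i)) C k)))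
    ≡⟨ ∑-cong k (λ {i} i≤k → trans (*-CS.x∙yz≈y∙xz (N C (k + k ∸ i)) (k C i) ((k + (k ∸ i)) C k))
                                   (cong ((k C i) *_) (revision i≤k))) ⟩
  ∑[ i ≤ k ] ((k C i) * ((N C k) * (n C (k ∸ i))))
    ≡⟨ ∑-cong k (λ {i} _ → *-CS.x∙yz≈y∙zx (k C i) (N C k) (n C (k ∸ i))) ⟩
  ∑[ i ≤ k ] ((N C k) * ((n C (k ∸ i)) * (k C i)))
    ≡⟨ sym (*-distribˡ-∑ k (N C k) _) ⟩
  (N C k) * ∑[ i ≤ k ] ((n C (k ∸ i)) * (k C i))
    ≡⟨ cong ((N C k) *_) (sym (C-vandermonde n k k)) ⟩
  (N C k) * ((n + k) C k)
    ≡⟨ cong (λ x → (N C k) * (x C k)) (ℕ.+-comm n k) ⟩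
  (N C k) ²
    ∎
  where
  N : ℕ
  N = k + n
  revision : ∀ {i} → i ≤ k → (N C (k + k ∸ i)) * ((k + (k ∸ i)) C k) ≡ (N C k) * (n C (k ∸ i))
  revision {i} i≤k = begin
    (N C (k + k ∸ i)) * ((k + (k ∸ i)) C k)
      ≡⟨ cong (λ x → (N C x) * ((k + (k ∸ i)) C k)) (ℕ.+-∸-assoc k i≤k) ⟩
    (N C (k + (k ∸ i))) * ((k + (k ∸ i)) C k)
      ≡⟨ C-revision N (ℕ.m≤m+n k (k ∸ i)) ⟩
    (N C k) * ((N ∸ k) C (k + (k ∸ i) ∸ k))
      ≡⟨ cong₂ (λ x y → (N C k) * (x C y)) (ℕ.m+n∸m≡n k n) (ℕ.m+n∸m≡n k (k ∸ i)) ⟩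
    (N C k) * (n C (k ∸ i))
      ∎

C²-convolution : ∀ k n → ((k + n) C k) ² ≡ ∑[ j ≤ n ] ((k C j) ² * ((k + k + (n ∸ j)) C (k + k)))
C²-convolution k n = sym (begin
  ∑[ j ≤ n ] ((k C j) ² * ((k + k + (n ∸ j)) C (k + k)))   ≡⟨ ∑-cong n reindex ⟩
  ∑[ j ≤ n ] F j                                          ≡⟨ sym (∑-shrink F (ℕ.m≤m+n n k) F-beyond-n) ⟩
  ∑[ j ≤ n + k ] F j                                      ≡⟨ ∑-shrink F (ℕ.m≤n+m k n) F-beyond-k ⟩
  ∑[ j ≤ k ] F j                                          ≡⟨ C²-convolution-≤k k n ⟩
  ((k + n) C k) ²                                         ∎)
  where
  F : ℕ → ℕ
  F j = (k C j) ² * ((k + n + (k ∸ j)) C (k + k))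

  reindex : ∀ {j} → j ≤ n → (k C j) ² * ((k + k + (n ∸ j)) C (k + k)) ≡ F j
  reindex {j} j≤n with j ≤? k
  ... | no j≰k rewrite k>n⇒nCk≡0 (ℕ.≰⇒> j≰k) = refl
  ... | yes j≤k = cong (λ x → (k C j) ² * (x C (k + k))) (begin
    k + k + (n ∸ j)    ≡⟨ ℕ.+-assoc k k (n ∸ j) ⟩
    k + (k + (n ∸ j))  ≡⟨ cong (_+_ k) (sym (ℕ.+-∸-assoc k j≤n)) ⟩
    k + (k + n ∸ j)    ≡⟨ cong (λ x → k + (x ∸ j)) (ℕ.+-comm k n) ⟩
    k + (n + k ∸ j)    ≡⟨ cong (_+_ k) (ℕ.+-∸-assoc n j≤k) ⟩
    k + (n + (k ∸ j))  ≡⟨ sym (ℕ.+-assoc k n (k ∸ j)) ⟩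
    k + n + (k ∸ j)    ∎)

  F-beyond-k : ∀ {j} → k < j → F j ≡ 0
  F-beyond-k k<j rewrite k>n⇒nCk≡0 k<j = refl

  F-beyond-n : ∀ {j} → n < j → F j ≡ 0
  F-beyond-n {j} n<j with j ≤? k
  ... | no j≰k  = F-beyond-k (ℕ.≰⇒> j≰k)
  ... | yes j≤k = trans (cong ((k C j) ² *_) (k>n⇒nCk≡0 short)) (ℕ.*-zeroʳ ((k C j) ²))
    where
    short : k + n + (k ∸ j) < k + k
    short = subst (_< k + k) (sym (ℕ.+-assoc k n (k ∸ j)))
              (ℕ.+-monoʳ-< k (subst (n + (k ∸ j) <_) (ℕ.m+[n∸m]≡n j≤k) (ℕ.+-monoˡ-< (k ∸ j) n<j)))

-- Lattice points of the order polytope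

𝟙 : ∀ {a} {A : Set a} → Dec A → ℕ
𝟙 (yes _) = 1
𝟙 (no _)  = 0

𝟙-×-dec : ∀ {a b} {A : Set a} {B : Set b} (a? : Dec A) (b? : Dec B) → 𝟙 (a? ×-dec b?) ≡ 𝟙 a? * 𝟙 b?
𝟙-×-dec (yes _) (yes _) = refl
𝟙-×-dec (yes _) (no _)  = refl
𝟙-×-dec (no _)  _       = refl

𝟙-⇔ : ∀ {a b} {A : Set a} {B : Set b} → A ⇔ B → (a? : Dec A) (b? : Dec B) → 𝟙 a? ≡ 𝟙 b?
𝟙-⇔ A⇔B (yes _) (yes _) = refl
𝟙-⇔ A⇔B (yes a) (no ¬b) = contradiction (Equivalence.to A⇔B a) ¬b
𝟙-⇔ A⇔B (no ¬a) (yes b) = contradiction (Equivalence.from A⇔B b) ¬a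
𝟙-⇔ A⇔B (no _)  (no _)  = refl

length-filter≡sum-𝟙 : ∀ {a p} {A : Set a} {P : Pred A p} (P? : Decidable P) xs →
                      length (filter P? xs) ≡ sum (map (𝟙 ∘ P?) xs)
length-filter≡sum-𝟙 P? []       = refl
length-filter≡sum-𝟙 P? (x ∷ xs) with P? x
... | yes _ = cong suc (length-filter≡sum-𝟙 P? xs)
... | no _  = length-filter≡sum-𝟙 P? xs

∑-𝟙≤ : ∀ {a n} → a ≤ n → ∀ f → ∑[ b ≤ n ] (𝟙 (a ≤? b) * f b) ≡ ∑[ j ≤ n ∸ a ] f (a + j)
∑-𝟙≤ {n = n} z≤n f = ∑-cong n (λ {b} _ → ℕ.+-identityʳ (f b))
∑-𝟙≤ {suc a} {suc n} (s≤s a≤n) f = begin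
  ∑[ b ≤ suc n ] (𝟙 (suc a ≤? b) * f b)
    ≡⟨ ∑-suc n (λ b → 𝟙 (suc a ≤? b) * f b) ⟩
  ∑[ b ≤ n ] (𝟙 (suc a ≤? suc b) * f (suc b))
    ≡⟨ ∑-cong n (λ {b} _ → cong (_* f (suc b)) (𝟙-⇔ (mk⇔ ℕ.s≤s⁻¹ s≤s) (suc a ≤? suc b) (a ≤? b))) ⟩
  ∑[ b ≤ n ] (𝟙 (a ≤? b) * f (suc b))
    ≡⟨ ∑-𝟙≤ a≤n (λ b → f (suc b)) ⟩
  ∑[ j ≤ n ∸ a ] f (suc a + j)
    ∎

sum-map-*ˡ : ∀ {a} {A : Set a} c (w : A → ℕ) xs → sum (map (λ x → c * w x) xs) ≡ c * sum (map w xs)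
sum-map-*ˡ c w []       = sym (ℕ.*-zeroʳ c)
sum-map-*ˡ c w (x ∷ xs) = trans (cong (_+_ (c * w x)) (sum-map-*ˡ c w xs)) (sym (ℕ.*-distribˡ-+ c (w x) _))

sum-map-concatMap : ∀ {a b} {A : Set a} {B : Set b} (w : B → ℕ) (g : A → List B) xs →
                    sum (map w (concatMap g xs)) ≡ sum (map (λ x → sum (map w (g x))) xs)
sum-map-concatMap w g []       = refl
sum-map-concatMap w g (x ∷ xs) = begin
  sum (map w (g x List.++ concatMap g xs))             ≡⟨ cong sum (map-++ w (g x) _) ⟩
  sum (map w (g x) List.++ map w (concatMap g xs))     ≡⟨ sum-++ (map w (g x)) _ ⟩
  sum (map w (g x)) + sum (map w (concatMap g xs))     ≡⟨ cong (_+_ (sum (map w (g x)))) (sum-map-concatMap w g xs) ⟩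
  sum (map w (g x)) + sum (map (λ x → sum (map w (g x))) xs) ∎

sum-map-applyUpTo : ∀ (w : ℕ → ℕ) f n → sum (map w (applyUpTo f (suc n))) ≡ ∑[ i ≤ n ] w (f i)
sum-map-applyUpTo w f zero    = ℕ.+-identityʳ (w (f 0))
sum-map-applyUpTo w f (suc n) =
  trans (cong (_+_ (w (f 0))) (sum-map-applyUpTo w (λ i → f (suc i)) n)) (sym (∑-suc n (w ∘ f)))

boxSum : ∀ n p → (Vec ℕ p → ℕ) → ℕ
boxSum n p W = sum (map W (box n p))

boxSum-cong : ∀ n p {W W′ : Vec ℕ p → ℕ} → (∀ v → W v ≡ W′ v) → boxSum n p W ≡ boxSum n p W′
boxSum-cong n p W≗W′ = cong sum (map-cong W≗W′ (box n p))

boxSum-∷ : ∀ n p W → boxSum n (suc p) W ≡ ∑[ a ≤ n ] boxSum n p (λ v → W (a ∷ v))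
boxSum-∷ n p W = begin
  sum (map W (concatMap (λ a → map (a ∷_) (box n p)) (upTo (suc n))))
    ≡⟨ sum-map-concatMap W (λ a → map (a ∷_) (box n p)) (upTo (suc n)) ⟩
  sum (map (λ a → sum (map W (map (a ∷_) (box n p)))) (upTo (suc n)))
    ≡⟨ cong sum (map-cong (λ a → cong sum (sym (map-∘ (box n p)))) (upTo (suc n))) ⟩
  sum (map (λ a → boxSum n p (λ v → W (a ∷ v))) (upTo (suc n)))
    ≡⟨ sum-map-applyUpTo _ (λ i → i) n ⟩
  ∑[ a ≤ n ] boxSum n p (λ v → W (a ∷ v))
    ∎

boxSum-++ : ∀ n p {q} W → boxSum n (p + q) W ≡ boxSum n p (λ u → boxSum n q (λ w → W (u ++ w)))
boxSum-++ n zero    W = sym (ℕ.+-identityʳ _)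
boxSum-++ n (suc p) W = begin
  boxSum n (suc p + _) W
    ≡⟨ boxSum-∷ n (p + _) W ⟩
  ∑[ a ≤ n ] boxSum n (p + _) (λ v → W (a ∷ v))
    ≡⟨ ∑-cong n (λ {a} _ → boxSum-++ n p (λ v → W (a ∷ v))) ⟩
  ∑[ a ≤ n ] boxSum n p (λ u → boxSum n _ (λ w → W (a ∷ u ++ w)))
    ≡⟨ sym (boxSum-∷ n p _) ⟩
  boxSum n (suc p) (λ u → boxSum n _ (λ w → W (u ++ w)))
    ∎

boxSum-* : ∀ n p q (U : Vec ℕ p → ℕ) (V : Vec ℕ q → ℕ) →
           boxSum n p (λ u → boxSum n q (λ w → U u * V w)) ≡ boxSum n p U * boxSum n q V
boxSum-* n p q U V = begin
  boxSum n p (λ u → boxSum n q (λ w → U u * V w))   ≡⟨ boxSum-cong n p (λ u → sum-map-*ˡ (U u) V (box n q)) ⟩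
  boxSum n p (λ u → U u * boxSum n q V)             ≡⟨ boxSum-cong n p (λ u → ℕ.*-comm (U u) _) ⟩
  boxSum n p (λ u → boxSum n q V * U u)             ≡⟨ sum-map-*ˡ (boxSum n q V) U (box n p) ⟩
  boxSum n q V * boxSum n p U                       ≡⟨ ℕ.*-comm (boxSum n q V) _ ⟩
  boxSum n p U * boxSum n q V                       ∎

ehr≡boxSum : ∀ P n → ehr P n ≡ boxSum n (size P) (𝟙 ∘ orderPreserving? P)
ehr≡boxSum P n = length-filter≡sum-𝟙 (orderPreserving? P) (box n (size P))

AscendingFrom : ∀ {p} → ℕ → Vec ℕ p → Set
AscendingFrom a []       = ⊤
AscendingFrom a (x ∷ xs) = a ≤ x × AscendingFrom x xs

ascendingFrom? : ∀ {p} a (xs : Vec ℕ p) → Dec (AscendingFrom a xs)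
ascendingFrom? a []       = yes tt
ascendingFrom? a (x ∷ xs) = a ≤? x ×-dec ascendingFrom? x xs

boxSum-ascendingFrom : ∀ n k {a} → a ≤ n → boxSum n k (𝟙 ∘ ascendingFrom? a) ≡ (k + (n ∸ a)) C k
boxSum-ascendingFrom n zero    a≤n = refl
boxSum-ascendingFrom n (suc k) {a} a≤n = begin
  boxSum n (suc k) (𝟙 ∘ ascendingFrom? a)
    ≡⟨ boxSum-∷ n k _ ⟩
  ∑[ b ≤ n ] boxSum n k (λ v → 𝟙 (a ≤? b ×-dec ascendingFrom? b v))
    ≡⟨ ∑-cong n (λ {b} _ → trans (boxSum-cong n k (λ v → 𝟙-×-dec (a ≤? b) _))
                                 (sum-map-*ˡ (𝟙 (a ≤? b)) _ (box n k))) ⟩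
  ∑[ b ≤ n ] (𝟙 (a ≤? b) * boxSum n k (𝟙 ∘ ascendingFrom? b))
    ≡⟨ ∑-cong n (λ {b} b≤n → cong (𝟙 (a ≤? b) *_) (boxSum-ascendingFrom n k b≤n)) ⟩
  ∑[ b ≤ n ] (𝟙 (a ≤? b) * ((k + (n ∸ b)) C k))
    ≡⟨ ∑-𝟙≤ a≤n (λ b → (k + (n ∸ b)) C k) ⟩
  ∑[ j ≤ n ∸ a ] ((k + (n ∸ (a + j))) C k)
    ≡⟨ ∑-cong (n ∸ a) (λ {j} _ → cong (λ x → (k + x) C k) (sym (ℕ.∸-+-assoc n a j))) ⟩
  ∑[ j ≤ n ∸ a ] ((k + (n ∸ a ∸ j)) C k)
    ≡⟨ sym (∑-reverse (n ∸ a) (λ j → (k + j) C k)) ⟩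
  ∑[ j ≤ n ∸ a ] ((k + j) C k)
    ≡⟨ ∑-C-hockey k (n ∸ a) ⟩
  (suc k + (n ∸ a)) C suc k
    ∎

Monotone : (P : FinPoset) → Vec ℕ (size P) → Set
Monotone P v = ∀ i j → _⪯_ P i j → lookup v i ≤ lookup v j

orderPreserving⇔monotone : ∀ P {v} → OrderPreserving P v ⇔ Monotone P v
orderPreserving⇔monotone P {v} = mk⇔ to from
  where
  to : OrderPreserving P v → Monotone P v
  to op i j i⪯j with ListAll.lookup (ListAll.lookup op (∈-allFin i)) (∈-allFin j)
  ... | inj₁ i⋠j   = contradiction i⪯j i⋠j
  ... | inj₂ vi≤vj = vi≤vj
  from : Monotone P v → OrderPreserving P v
  from mono = tabulate⁺ λ i → tabulate⁺ λ j → decide i j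
    where
    decide : ∀ i j → ¬ (_⪯_ P i j) ⊎ (lookup v i ≤ lookup v j)
    decide i j with _⪯?_ P i j
    ... | yes i⪯j = inj₂ (mono i j i⪯j)
    ... | no i⋠j  = inj₁ i⋠j

monotone-chain-∷ : ∀ {p x} {v : Vec ℕ p} →
                   Monotone (chain (suc p)) (x ∷ v) ⇔ (All (x ≤_) v × Monotone (chain p) v)
monotone-chain-∷ {p} {x} {v} = mk⇔ to from
  where
  to : Monotone (chain (suc p)) (x ∷ v) → All (x ≤_) v × Monotone (chain p) v
  to mono = lookup⁻ (λ j → mono zero (suc j) z≤n) , λ i j i≤j → mono (suc i) (suc j) (s≤s i≤j)
  from : All (x ≤_) v × Monotone (chain p) v → Monotone (chain (suc p)) (x ∷ v)
  from (x≤v , mono) zero    zero    _         = ℕ.≤-refl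
  from (x≤v , mono) zero    (suc j) _         = lookup⁺ x≤v j
  from (x≤v , mono) (suc i) (suc j) (s≤s i≤j) = mono i j i≤j

monotone-I₁⊕ : ∀ Q {a v} → Monotone (chain 1 ⊕P Q) (a ∷ v) ⇔ (All (a ≤_) v × Monotone Q v)
monotone-I₁⊕ Q {a} {v} = mk⇔ to from
  where
  to : Monotone (chain 1 ⊕P Q) (a ∷ v) → All (a ≤_) v × Monotone Q v
  to mono = lookup⁻ (λ j → mono zero (suc j) tt) , λ i j → mono (suc i) (suc j)
  from : All (a ≤_) v × Monotone Q v → Monotone (chain 1 ⊕P Q) (a ∷ v)
  from (a≤v , mono) zero    zero    _   = ℕ.≤-refl
  from (a≤v , mono) zero    (suc j) _   = lookup⁺ a≤v j
  from (a≤v , mono) (suc i) (suc j) i⪯j = mono i j i⪯j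

monotone-+P : ∀ P Q {u w} → Monotone (P +P Q) (u ++ w) ⇔ (Monotone P u × Monotone Q w)
monotone-+P P Q {u} {w} = mk⇔ to from
  where
  p q : ℕ
  p = size P
  q = size Q
  ↑ˡ-⪯ : ∀ {x y} → _⪯_ P x y → _⪯_ (P +P Q) (x ↑ˡ q) (y ↑ˡ q)
  ↑ˡ-⪯ {x} {y} x⪯y rewrite splitAt-↑ˡ p x q | splitAt-↑ˡ p y q = x⪯y
  ↑ʳ-⪯ : ∀ {x y} → _⪯_ Q x y → _⪯_ (P +P Q) (p ↑ʳ x) (p ↑ʳ y)
  ↑ʳ-⪯ {x} {y} x⪯y rewrite splitAt-↑ʳ p q x | splitAt-↑ʳ p q y = x⪯y
  lookup-inj₁ : ∀ {i x} → splitAt p i ≡ inj₁ x → lookup u x ≡ lookup (u ++ w) i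
  lookup-inj₁ {x = x} eq = trans (sym (lookup-++ˡ u w x)) (cong (lookup (u ++ w)) (splitAt⁻¹-↑ˡ eq))
  lookup-inj₂ : ∀ {i x} → splitAt p i ≡ inj₂ x → lookup w x ≡ lookup (u ++ w) i
  lookup-inj₂ {x = x} eq = trans (sym (lookup-++ʳ u w x)) (cong (lookup (u ++ w)) (splitAt⁻¹-↑ʳ eq))
  to : Monotone (P +P Q) (u ++ w) → Monotone P u × Monotone Q w
  to mono = (λ x y x⪯y → subst₂ _≤_ (lookup-++ˡ u w x) (lookup-++ˡ u w y) (mono _ _ (↑ˡ-⪯ x⪯y)))
          , (λ x y x⪯y → subst₂ _≤_ (lookup-++ʳ u w x) (lookup-++ʳ u w y) (mono _ _ (↑ʳ-⪯ x⪯y)))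
  from : Monotone P u × Monotone Q w → Monotone (P +P Q) (u ++ w)
  from (mu , mw) i j i⪯j with splitAt p i in eqᵢ | splitAt p j in eqⱼ
  ... | inj₁ x | inj₁ y = subst₂ _≤_ (lookup-inj₁ eqᵢ) (lookup-inj₁ eqⱼ) (mu x y i⪯j)
  ... | inj₂ x | inj₂ y = subst₂ _≤_ (lookup-inj₂ eqᵢ) (lookup-inj₂ eqⱼ) (mw x y i⪯j)
  ... | inj₁ _ | inj₂ _ = ⊥-elim i⪯j
  ... | inj₂ _ | inj₁ _ = ⊥-elim i⪯j

ascendingFrom⇔ : ∀ {p a} {v : Vec ℕ p} → AscendingFrom a v ⇔ (All (a ≤_) v × Monotone (chain p) v)
ascendingFrom⇔ = mk⇔ to from
  where
  to : ∀ {p a} {v : Vec ℕ p} → AscendingFrom a v → All (a ≤_) v × Monotone (chain p) v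
  to {v = []}    _           = [] , λ ()
  to {v = x ∷ v} (a≤x , x↗v) with to x↗v
  ... | x≤v , mono = a≤x ∷ All.map (ℕ.≤-trans a≤x) x≤v , Equivalence.from monotone-chain-∷ (x≤v , mono)
  from : ∀ {p a} {v : Vec ℕ p} → All (a ≤_) v × Monotone (chain p) v → AscendingFrom a v
  from {v = []}    _               = tt
  from {v = x ∷ v} (a≤x ∷ _ , mono) = a≤x , from (Equivalence.to monotone-chain-∷ mono)

orderPreserving-I₁⊕[Iₖ+Iₖ] : ∀ k {a} {u w : Vec ℕ k} →
  OrderPreserving (chain 1 ⊕P (chain k +P chain k)) (a ∷ u ++ w) ⇔ (AscendingFrom a u × AscendingFrom a w)
orderPreserving-I₁⊕[Iₖ+Iₖ] k {a} {u} {w} = mk⇔ to from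
  where
  Q : FinPoset
  Q = chain k +P chain k
  module OP = Equivalence (orderPreserving⇔monotone (chain 1 ⊕P Q) {a ∷ u ++ w})
  module ⊕ = Equivalence (monotone-I₁⊕ Q {a} {u ++ w})
  module + = Equivalence (monotone-+P (chain k) (chain k) {u} {w})
  module ↗ {v : Vec ℕ k} = Equivalence (ascendingFrom⇔ {k} {a} {v})
  to : OrderPreserving (chain 1 ⊕P Q) (a ∷ u ++ w) → AscendingFrom a u × AscendingFrom a w
  to op with ⊕.to (OP.to op)
  ... | a≤uw , mono with ++⁻ u a≤uw | +.to mono
  ... | a≤u , a≤w | mu , mw = ↗.from (a≤u , mu) , ↗.from (a≤w , mw)
  from : AscendingFrom a u × AscendingFrom a w → OrderPreserving (chain 1 ⊕P Q) (a ∷ u ++ w)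
  from (a↗u , a↗w) with ↗.to a↗u | ↗.to a↗w
  ... | a≤u , mu | a≤w , mw = OP.from (⊕.from (++⁺ a≤u a≤w , +.from (mu , mw)))

ehr-I₁⊕[Iₖ+Iₖ] : ∀ k n → ehr (chain 1 ⊕P (chain k +P chain k)) n ≡ ∑[ i ≤ n ] (((k + i) C k) ²)
ehr-I₁⊕[Iₖ+Iₖ] k n = begin
  ehr P n
    ≡⟨ ehr≡boxSum P n ⟩
  boxSum n (suc (k + k)) (𝟙 ∘ orderPreserving? P)
    ≡⟨ boxSum-∷ n (k + k) _ ⟩
  ∑[ a ≤ n ] boxSum n (k + k) (λ v → 𝟙 (orderPreserving? P (a ∷ v)))
    ≡⟨ ∑-cong n fibre ⟩
  ∑[ a ≤ n ] (((k + (n ∸ a)) C k) ²)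
    ≡⟨ ∑-reverse n (λ a → ((k + (n ∸ a)) C k) ²) ⟩
  ∑[ i ≤ n ] (((k + (n ∸ (n ∸ i))) C k) ²)
    ≡⟨ ∑-cong n (λ i≤n → cong (λ x → ((k + x) C k) ²) (ℕ.m∸[m∸n]≡n i≤n)) ⟩
  ∑[ i ≤ n ] (((k + i) C k) ²)
    ∎
  where
  P : FinPoset
  P = chain 1 ⊕P (chain k +P chain k)
  fibre : ∀ {a} → a ≤ n → boxSum n (k + k) (λ v → 𝟙 (orderPreserving? P (a ∷ v))) ≡ ((k + (n ∸ a)) C k) ²
  fibre {a} a≤n = begin
    boxSum n (k + k) (λ v → 𝟙 (orderPreserving? P (a ∷ v)))
      ≡⟨ boxSum-++ n k _ ⟩
    boxSum n k (λ u → boxSum n k (λ w → 𝟙 (orderPreserving? P (a ∷ u ++ w))))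
      ≡⟨ boxSum-cong n k (λ u → boxSum-cong n k λ w →
           trans (𝟙-⇔ (orderPreserving-I₁⊕[Iₖ+Iₖ] k) _ _) (𝟙-×-dec (ascendingFrom? a u) (ascendingFrom? a w))) ⟩
    boxSum n k (λ u → boxSum n k (λ w → 𝟙 (ascendingFrom? a u) * 𝟙 (ascendingFrom? a w)))
      ≡⟨ boxSum-* n k k _ _ ⟩
    boxSum n k (𝟙 ∘ ascendingFrom? a) * boxSum n k (𝟙 ∘ ascendingFrom? a)
      ≡⟨ cong (λ x → x * x) (boxSum-ascendingFrom n k a≤n) ⟩
    ((k + (n ∸ a)) C k) ²
      ∎

-- Power series

module ℤ∑ = FiniteSum ℤ.+-*-commutativeSemiring

sumTo≡∑ : ∀ n f → sumTo n f ≡ ℤ∑.∑≤ n f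
sumTo≡∑ zero    f = refl
sumTo≡∑ (suc n) f = cong (ℤ._+ f (suc n)) (sumTo≡∑ n f)

pos-∑ : ∀ n f → + ∑≤ n f ≡ ℤ∑.∑≤ n (λ i → + f i)
pos-∑ zero    f = refl
pos-∑ (suc n) f = trans (ℤ.pos-+ (∑≤ n f) (f (suc n))) (cong (ℤ._+ + f (suc n)) (pos-∑ n f))

*S-coeff : ∀ f g n → (f *S g) n ≡ ℤ∑.∑≤ n (λ j → f j ℤ.* g (n ∸ j))
*S-coeff f g n = sumTo≡∑ n _

*S-congˡ : ∀ f {g g′} → g ≗ g′ → f *S g ≗ f *S g′
*S-congˡ f {g} {g′} g≗g′ n = begin
  (f *S g) n                                ≡⟨ *S-coeff f g n ⟩
  ℤ∑.∑≤ n (λ j → f j ℤ.* g (n ∸ j))         ≡⟨ ℤ∑.∑-cong n (λ {j} _ → cong (f j ℤ.*_) (g≗g′ (n ∸ j))) ⟩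
  ℤ∑.∑≤ n (λ j → f j ℤ.* g′ (n ∸ j))        ≡⟨ sym (*S-coeff f g′ n) ⟩
  (f *S g′) n                               ∎

*S-comm : ∀ f g → f *S g ≗ g *S f
*S-comm f g n = begin
  (f *S g) n                                          ≡⟨ *S-coeff f g n ⟩
  ℤ∑.∑≤ n (λ j → f j ℤ.* g (n ∸ j))                   ≡⟨ ℤ∑.∑-reverse n _ ⟩
  ℤ∑.∑≤ n (λ j → f (n ∸ j) ℤ.* g (n ∸ (n ∸ j)))       ≡⟨ ℤ∑.∑-cong n flip ⟩
  ℤ∑.∑≤ n (λ j → g j ℤ.* f (n ∸ j))                   ≡⟨ sym (*S-coeff g f n) ⟩
  (g *S f) n                                          ∎
  where
  flip : ∀ {j} → j ≤ n → f (n ∸ j) ℤ.* g (n ∸ (n ∸ j)) ≡ g j ℤ.* f (n ∸ j)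
  flip {j} j≤n = trans (cong (λ i → f (n ∸ j) ℤ.* g i) (ℕ.m∸[m∸n]≡n j≤n)) (ℤ.*-comm (f (n ∸ j)) (g j))

*S-congʳ : ∀ h {f f′} → f ≗ f′ → f *S h ≗ f′ *S h
*S-congʳ h {f} {f′} f≗f′ n = begin
  (f *S h) n   ≡⟨ *S-comm f h n ⟩
  (h *S f) n   ≡⟨ *S-congˡ h f≗f′ n ⟩
  (h *S f′) n  ≡⟨ *S-comm h f′ n ⟩
  (f′ *S h) n  ∎

*S-assoc : ∀ f g h → (f *S g) *S h ≗ f *S (g *S h)
*S-assoc f g h n = begin
  ((f *S g) *S h) n
    ≡⟨ *S-coeff (f *S g) h n ⟩
  ℤ∑.∑≤ n (λ j → (f *S g) j ℤ.* h (n ∸ j))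
    ≡⟨ ℤ∑.∑-cong n (λ {j} _ → trans (cong (ℤ._* h (n ∸ j)) (*S-coeff f g j))
                                     (ℤ∑.*-distribʳ-∑ j (h (n ∸ j)) _)) ⟩
  ℤ∑.∑≤ n (λ j → ℤ∑.∑≤ j (λ i → f i ℤ.* g (j ∸ i) ℤ.* h (n ∸ j)))
    ≡⟨ ℤ∑.∑-triangle n (λ i j → f i ℤ.* g (j ∸ i) ℤ.* h (n ∸ j)) ⟩
  ℤ∑.∑≤ n (λ i → ℤ∑.∑≤ (n ∸ i) (λ l → f i ℤ.* g (i + l ∸ i) ℤ.* h (n ∸ (i + l))))
    ≡⟨ ℤ∑.∑-cong n (λ {i} _ → ℤ∑.∑-cong (n ∸ i) (λ {l} _ → reassociate i l)) ⟩
  ℤ∑.∑≤ n (λ i → ℤ∑.∑≤ (n ∸ i) (λ l → f i ℤ.* (g l ℤ.* h (n ∸ i ∸ l))))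
    ≡⟨ ℤ∑.∑-cong n (λ {i} _ → trans (sym (ℤ∑.*-distribˡ-∑ (n ∸ i) (f i) _))
                                     (cong (f i ℤ.*_) (sym (*S-coeff g h (n ∸ i))))) ⟩
  ℤ∑.∑≤ n (λ i → f i ℤ.* (g *S h) (n ∸ i))
    ≡⟨ sym (*S-coeff f (g *S h) n) ⟩
  (f *S (g *S h)) n
    ∎
  where
  reassociate : ∀ i l → f i ℤ.* g (i + l ∸ i) ℤ.* h (n ∸ (i + l)) ≡ f i ℤ.* (g l ℤ.* h (n ∸ i ∸ l))
  reassociate i l = trans (cong₂ (λ a b → f i ℤ.* g a ℤ.* h b) (ℕ.m+n∸m≡n i l) (sym (ℕ.∸-+-assoc n i l)))
                          (ℤ.*-assoc (f i) (g l) (h (n ∸ i ∸ l)))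

*S-identityˡ : ∀ f → oneS *S f ≗ f
*S-identityˡ f zero    = ℤ.*-identityˡ (f 0)
*S-identityˡ f (suc n) = begin
  (oneS *S f) (suc n)
    ≡⟨ *S-coeff oneS f (suc n) ⟩
  ℤ∑.∑≤ (suc n) (λ j → oneS j ℤ.* f (suc n ∸ j))
    ≡⟨ ℤ∑.∑-suc n _ ⟩
  + 1 ℤ.* f (suc n) ℤ.+ ℤ∑.∑≤ n (λ j → + 0 ℤ.* f (n ∸ j))
    ≡⟨ cong₂ ℤ._+_ (ℤ.*-identityˡ (f (suc n))) (ℤ∑.∑-zero n (λ _ → refl)) ⟩
  f (suc n) ℤ.+ + 0
    ≡⟨ ℤ.+-identityʳ (f (suc n)) ⟩
  f (suc n)
    ∎

oneMinusX-*S : ∀ f n → (oneMinusX *S f) (suc n) ≡ f (suc n) ℤ.- f n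
oneMinusX-*S f n = begin
  (oneMinusX *S f) (suc n)
    ≡⟨ *S-coeff oneMinusX f (suc n) ⟩
  ℤ∑.∑≤ (suc n) (λ j → oneMinusX j ℤ.* f (suc n ∸ j))
    ≡⟨ ℤ∑.∑-suc n _ ⟩
  + 1 ℤ.* f (suc n) ℤ.+ ℤ∑.∑≤ n (λ j → oneMinusX (suc j) ℤ.* f (n ∸ j))
    ≡⟨ cong₂ ℤ._+_ (ℤ.*-identityˡ (f (suc n))) (lower-terms n) ⟩
  f (suc n) ℤ.- f n
    ∎
  where
  lower-terms : ∀ n → ℤ∑.∑≤ n (λ j → oneMinusX (suc j) ℤ.* f (n ∸ j)) ≡ ℤ.- f n
  lower-terms zero    = ℤ.-1*i≡-i (f 0)
  lower-terms (suc n) = begin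
    ℤ∑.∑≤ (suc n) (λ j → oneMinusX (suc j) ℤ.* f (suc n ∸ j))
      ≡⟨ ℤ∑.∑-suc n _ ⟩
    ℤ.-1ℤ ℤ.* f (suc n) ℤ.+ ℤ∑.∑≤ n (λ j → + 0 ℤ.* f (n ∸ j))
      ≡⟨ cong₂ ℤ._+_ (ℤ.-1*i≡-i (f (suc n))) (ℤ∑.∑-zero n (λ _ → refl)) ⟩
    ℤ.- f (suc n) ℤ.+ + 0
      ≡⟨ ℤ.+-identityʳ _ ⟩
    ℤ.- f (suc n)
      ∎

-- the coefficients of (1 - x) ^ -(m + 1)
binomialSeries : ℕ → Series
binomialSeries m n = + ((m + n) C m)

oneMinusX-*S-binomialSeries₀ : oneMinusX *S binomialSeries 0 ≗ oneS
oneMinusX-*S-binomialSeries₀ zero    = refl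
oneMinusX-*S-binomialSeries₀ (suc n) = oneMinusX-*S (binomialSeries 0) n

oneMinusX-*S-binomialSeries : ∀ m → oneMinusX *S binomialSeries (suc m) ≗ binomialSeries m
oneMinusX-*S-binomialSeries m zero    =
  trans (ℤ.*-identityˡ _) (cong +_ (trans ([n+0]Cn≡1 (suc m)) (sym ([n+0]Cn≡1 m))))
oneMinusX-*S-binomialSeries m (suc n) = begin
  (oneMinusX *S binomialSeries (suc m)) (suc n)
    ≡⟨ oneMinusX-*S (binomialSeries (suc m)) n ⟩
  + (suc (m + suc n) C suc m) ℤ.- + (suc (m + n) C suc m)
    ≡⟨ cong₂ (λ x y → + x ℤ.- + (y C suc m)) (C-pascal (m + suc n) m) (sym (ℕ.+-suc m n)) ⟩
  + ((m + suc n) C m + (m + suc n) C suc m) ℤ.- + ((m + suc n) C suc m)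
    ≡⟨ +[x+y]-+y≡+x ((m + suc n) C m) ((m + suc n) C suc m) ⟩
  + ((m + suc n) C m)
    ∎
  where
  +[x+y]-+y≡+x : ∀ x y → + (x + y) ℤ.- + y ≡ + x
  +[x+y]-+y≡+x x y = trans (ℤ.m-n≡m⊖n (x + y) y) (trans (ℤ.⊖-≥ (ℕ.m≤n+m y x)) (cong +_ (ℕ.m+n∸n≡m x y)))

oneMinusX^S-*S-binomialSeries : ∀ m → (oneMinusX ^S suc m) *S binomialSeries m ≗ oneS
oneMinusX^S-*S-binomialSeries zero n = begin
  ((oneMinusX *S oneS) *S binomialSeries 0) n    ≡⟨ *S-assoc oneMinusX oneS (binomialSeries 0) n ⟩
  (oneMinusX *S (oneS *S binomialSeries 0)) n    ≡⟨ *S-congˡ oneMinusX (*S-identityˡ (binomialSeries 0)) n ⟩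
  (oneMinusX *S binomialSeries 0) n              ≡⟨ oneMinusX-*S-binomialSeries₀ n ⟩
  oneS n                                         ∎
oneMinusX^S-*S-binomialSeries (suc m) n = begin
  ((oneMinusX *S (oneMinusX ^S suc m)) *S binomialSeries (suc m)) n
    ≡⟨ *S-congʳ (binomialSeries (suc m)) (*S-comm oneMinusX (oneMinusX ^S suc m)) n ⟩
  (((oneMinusX ^S suc m) *S oneMinusX) *S binomialSeries (suc m)) n
    ≡⟨ *S-assoc (oneMinusX ^S suc m) oneMinusX (binomialSeries (suc m)) n ⟩
  ((oneMinusX ^S suc m) *S (oneMinusX *S binomialSeries (suc m))) n
    ≡⟨ *S-congˡ (oneMinusX ^S suc m) (oneMinusX-*S-binomialSeries m) n ⟩
  ((oneMinusX ^S suc m) *S binomialSeries m) n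
    ≡⟨ oneMinusX^S-*S-binomialSeries m n ⟩
  oneS n
    ∎

binomialSeries₀-*S : ∀ f n → (binomialSeries 0 *S f) n ≡ ℤ∑.∑≤ n f
binomialSeries₀-*S f n = begin
  (binomialSeries 0 *S f) n                    ≡⟨ *S-coeff (binomialSeries 0) f n ⟩
  ℤ∑.∑≤ n (λ j → + 1 ℤ.* f (n ∸ j))            ≡⟨ ℤ∑.∑-cong n (λ {j} _ → ℤ.*-identityˡ (f (n ∸ j))) ⟩
  ℤ∑.∑≤ n (λ j → f (n ∸ j))                    ≡⟨ sym (ℤ∑.∑-reverse n f) ⟩
  ℤ∑.∑≤ n f                                    ∎

binomialSeries₀-*S-binomialSeries : ∀ m → binomialSeries 0 *S binomialSeries m ≗ binomialSeries (suc m)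
binomialSeries₀-*S-binomialSeries m n = begin
  (binomialSeries 0 *S binomialSeries m) n     ≡⟨ binomialSeries₀-*S (binomialSeries m) n ⟩
  ℤ∑.∑≤ n (binomialSeries m)                   ≡⟨ sym (pos-∑ n (λ i → (m + i) C m)) ⟩
  + ∑[ i ≤ n ] ((m + i) C m)                    ≡⟨ cong +_ (∑-C-hockey m n) ⟩
  binomialSeries (suc m) n                     ∎

oneMinusX^S-*S-cancel : ∀ m h {E} → E ≗ binomialSeries 0 *S (h *S binomialSeries m) →
                       (oneMinusX ^S suc (suc m)) *S E ≗ h
oneMinusX^S-*S-cancel m h {E} E≗ n = begin
  (A *S E) n                                       ≡⟨ *S-congˡ A E≗ n ⟩
  (A *S (b 0 *S (h *S b m))) n                     ≡⟨ *S-congˡ A (*S-congˡ (b 0) (*S-comm h (b m))) n ⟩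
  (A *S (b 0 *S (b m *S h))) n                     ≡⟨ *S-congˡ A (λ i → sym (*S-assoc (b 0) (b m) h i)) n ⟩
  (A *S ((b 0 *S b m) *S h)) n                     ≡⟨ *S-congˡ A (*S-congʳ h (binomialSeries₀-*S-binomialSeries m)) n ⟩
  (A *S (b (suc m) *S h)) n                        ≡⟨ sym (*S-assoc A (b (suc m)) h n) ⟩
  ((A *S b (suc m)) *S h) n                        ≡⟨ *S-congʳ h (oneMinusX^S-*S-binomialSeries (suc m)) n ⟩
  (oneS *S h) n                                    ≡⟨ *S-identityˡ h n ⟩
  h n                                              ∎
  where
  A : Series
  A = oneMinusX ^S suc (suc m)
  b : ℕ → Series
  b = binomialSeries

binomialSquares : ℕ → Series
binomialSquares k j = + (k C j) ²

poly-≗ : ∀ d {c : Series} → (∀ {n} → d < n → c n ≡ + 0) → c ≗ poly d c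
poly-≗ d c-vanishes n with n ≤? d
... | yes _   = refl
... | no n≰d  = c-vanishes (ℕ.≰⇒> n≰d)

C²*binomialSeries : ∀ k n → + ((k + n) C k) ² ≡ (binomialSquares k *S binomialSeries (k + k)) n
C²*binomialSeries k n = begin
  + ((k + n) C k) ²
    ≡⟨ cong +_ (C²-convolution k n) ⟩
  + ∑[ j ≤ n ] ((k C j) ² * ((k + k + (n ∸ j)) C (k + k)))
    ≡⟨ pos-∑ n _ ⟩
  ℤ∑.∑≤ n (λ j → + ((k C j) ² * ((k + k + (n ∸ j)) C (k + k))))
    ≡⟨ ℤ∑.∑-cong n (λ {j} _ → ℤ.pos-* ((k C j) ²) _) ⟩
  ℤ∑.∑≤ n (λ j → + (k C j) ² ℤ.* binomialSeries (k + k) (n ∸ j))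
    ≡⟨ sym (*S-coeff (binomialSquares k) (binomialSeries (k + k)) n) ⟩
  (binomialSquares k *S binomialSeries (k + k)) n
    ∎

Ehr-I₁⊕[Iₖ+Iₖ] : ∀ k n → Ehr (chain 1 ⊕P (chain k +P chain k)) n ≡ + ∑[ i ≤ n ] (((k + i) C k) ²)
Ehr-I₁⊕[Iₖ+Iₖ] k zero    = cong +_ (sym (cong _² ([n+0]Cn≡1 k)))
Ehr-I₁⊕[Iₖ+Iₖ] k (suc n) = cong +_ (ehr-I₁⊕[Iₖ+Iₖ] k (suc n))

Ehr-I₁⊕[Iₖ+Iₖ]-rational : ∀ k → Ehr (chain 1 ⊕P (chain k +P chain k)) ≗
                          binomialSeries 0 *S (binomialSquares k *S binomialSeries (k + k))
Ehr-I₁⊕[Iₖ+Iₖ]-rational k n = begin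
  Ehr (chain 1 ⊕P (chain k +P chain k)) n                      ≡⟨ Ehr-I₁⊕[Iₖ+Iₖ] k n ⟩
  + ∑[ i ≤ n ] (((k + i) C k) ²)                                ≡⟨ pos-∑ n _ ⟩
  ℤ∑.∑≤ n (λ i → + ((k + i) C k) ²)                            ≡⟨ ℤ∑.∑-cong n (λ {i} _ → C²*binomialSeries k i) ⟩
  ℤ∑.∑≤ n (binomialSquares k *S binomialSeries (k + k))      ≡⟨ sym (binomialSeries₀-*S _ n) ⟩
  (binomialSeries 0 *S (binomialSquares k *S binomialSeries (k + k))) n ∎

proposition4p3 : (k : ℕ) → 1 ≤ k →
    let P = chain 1 ⊕P (chain k +P chain k) in
    ((n : ℕ) → Ehr P n ≡ + sumToℕ n (λ i → ((k + i) C k) * ((k + i) C k)))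
    × ((n : ℕ) → ((oneMinusX ^S (2 * k + 2)) *S Ehr P) n
                   ≡ poly k (λ i → + ((k C i) * (k C i))) n)
proposition4p3 k _ = Ehr-coefficients , numerator
  where
  P : FinPoset
  P = chain 1 ⊕P (chain k +P chain k)

  Ehr-coefficients : ∀ n → Ehr P n ≡ + sumToℕ n (λ i → ((k + i) C k) ²)
  Ehr-coefficients n = trans (Ehr-I₁⊕[Iₖ+Iₖ] k n) (cong +_ (sym (sumToℕ≡∑ n _)))

  numerator : ∀ n → ((oneMinusX ^S (2 * k + 2)) *S Ehr P) n ≡ poly k (binomialSquares k) n
  numerator n = begin
    ((oneMinusX ^S (2 * k + 2)) *S Ehr P) n
      ≡⟨ cong (λ e → ((oneMinusX ^S e) *S Ehr P) n) exponent ⟩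
    ((oneMinusX ^S (2 + (k + k))) *S Ehr P) n
      ≡⟨ oneMinusX^S-*S-cancel (k + k) (binomialSquares k) (Ehr-I₁⊕[Iₖ+Iₖ]-rational k) n ⟩
    binomialSquares k n
      ≡⟨ poly-≗ k (λ k<n → cong (λ x → + x ²) (k>n⇒nCk≡0 k<n)) n ⟩
    poly k (binomialSquares k) n
      ∎
    where
    exponent : 2 * k + 2 ≡ 2 + (k + k)
    exponent = trans (ℕ.+-comm (2 * k) 2) (cong (_+_ 2) (cong (_+_ k) (ℕ.+-identityʳ k)))
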